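{- If $S$ is a numerical semigroup and $\theta$ is an $\mathrm{i}$-pertinent map, then $\mathrm{C}(S)\le\mu(\theta,S)$.
   Context: A numerical semigroup is a subset $S\subseteq\mathbb{N}$ containing $0$, closed under addition, with finite complement in $\mathbb{N}$; $\mathcal{L}$ is the set of all numerical semigroups. $\mathrm{PF}(S)$ is the set of integers $x\notin S$ with $x+s\in S$ for all $s\in S\setminus\{0\}$. A set $A$ is $\mathrm{i}(S)$-pertinent if $A\subseteq\mathrm{PF}(S)$ and, whenever $\{a,b\}\subseteq A$ and $a+b\in\mathrm{PF}(S)$, then $a+b\in A$. A map $\theta:\mathcal{L}\setminus\{\mathbb{N}\}\to\mathscr{P}(\mathbb{N})$ is $\mathrm{i}$-pertinent if $\theta(S)$ is a nonempty $\mathrm{i}(S)$-pertinent set for all $S\neq\mathbb{N}$. Given such $\theta$ and $S$, set $S_0=S$, $S_{n+1}=S_n\cup\theta(S_n)$ if $S_n\ne\mathbb{N}$ and $S_{n+1}=\mathbb{N}$ otherwise; this gives a strictly increasing chain $S_0\subsetneq S_1\subsetneq\cdots$ that reaches $\mathbb{N}$, and $\mu(\theta,S)$ is the (least) index $n$ with $S_n=\mathbb{N}$. An ideal of a numerical semigroup $\Delta$ is a nonempty $I\subseteq\Delta$ with $I+\Delta\subseteq I$; $\mathcal{J}(\Delta)$ is the set of numerical semigroups $T$ with $T\setminus\{0\}$ an ideal of $\Delta$; $\mathcal{J}(\mathscr{F})=\bigcup_{\Delta\in\mathscr{F}}\mathcal{J}(\Delta)$; $\mathcal{J}^0(\mathbb{N})=\{\mathbb{N}\}$,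 $\mathcal{J}^{k+1}(\mathbb{N})=\mathcal{J}(\mathcal{J}^k(\mathbb{N}))$; $\mathrm{C}(S)=\min\{k\in\mathbb{N}\mid S\in\mathcal{J}^k(\mathbb{N})\}$. -}

module Defs where

open import Level using (0ℓ; Lift) renaming (suc to lsuc)
open import Data.Nat using (ℕ; zero; suc; _+_; _<_; _≤_)
open import Data.Product using (Σ; ∃; _×_; _,_)
open import Data.Sum using (_⊎_)
open import Data.List using (List)
open import Data.List.Membership.Propositional using (_∈_)
open import Relation.Nullary using (¬_)
open import Relation.Binary.PropositionalEquality using (_≡_; _≢_)
open import Function.Bundles using (_⇔_)

Subset : Set₁
Subset = ℕ → Set

IsN : Subset → Set
IsN S = ∀ x → S x

record IsNumSG (S : Subset) : Set where
  field
    has-zero  : S 0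
    closed    : ∀ a b → S a → S b → S (a + b)
    finite-co : Σ (List ℕ) λ L → ∀ x → ¬ S x → x ∈ L

-- Pseudo-Frobenius numbers (the nonnegative ones; for S ≠ ℕ all are positive).
PF : Subset → ℕ → Set
PF S x = ¬ S x × (∀ s → S s → s ≢ 0 → S (x + s))

IPertinentSet : Subset → Subset → Set
IPertinentSet S A =
  (∀ x → A x → PF S x) ×
  (∀ a b → A a → A b → PF S (a + b) → A (a + b))

-- θ is a map on sets: it respects extensional equality of subsets.
Extensional : (Subset → Subset) → Set₁
Extensional θ = ∀ S T → (∀ x → S x ⇔ T x) → ∀ x → θ S x ⇔ θ T x

IPertinentMap : (Subset → Subset) → Set₁
IPertinentMap θ = ∀ S → IsNumSG S → ¬ IsN S → (∃ λ x → θ S x) × IPertinentSet S (θ S)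

-- The chain S₀ = S, S_{n+1} = S_n ∪ θ(S_n)  (once S_n = ℕ, S_n ∪ θ(S_n) = ℕ anyway).
chain : (Subset → Subset) → Subset → ℕ → Subset
chain θ S zero    = S
chain θ S (suc n) = λ x → chain θ S n x ⊎ θ (chain θ S n) x

IsIdeal : Subset → Subset → Set
IsIdeal Δ I = (∃ λ x → I x) × (∀ x → I x → Δ x) × (∀ i d → I i → Δ d → I (i + d))

InJ : Subset → Subset → Set
InJ Δ T = IsNumSG T × IsIdeal Δ (λ x → T x × x ≢ 0)

InJk : ℕ → Subset → Set₁
InJk zero    T = Lift (lsuc 0ℓ) (IsNumSG T × IsN T)
InJk (suc k) T = Σ Subset λ Δ → InJk k Δ × InJ Δ T

{-# OPTIONS --safe #-}
module Submission where

-- Since θ(Sⱼ) ⊆ PF(Sⱼ), adding any element of Sⱼ₊₁ = Sⱼ ∪ θ(Sⱼ) to a nonzero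
-- element of Sⱼ stays in Sⱼ, so Sⱼ ∈ J(Sⱼ₊₁). Walking down the chain from
-- S_μ = ℕ gives S = S₀ ∈ J^μ(ℕ). Constructively, Sⱼ₊₁ being closed under + needs
-- to decide whether a sum of two pseudo-Frobenius numbers lies in Sⱼ; these
-- decisions concern finitely many numbers, so they may be assumed when proving
-- the negative statement θ(Sⱼ) ∩ Sⱼ = ∅, which in turn makes every layer
-- decidable by tracing each x back down from S_μ = ℕ.

open import Defs
open import Data.Nat using (ℕ; _<_; _≤_)
open import Data.Product using (∃; _×_)
open import Relation.Nullary using (¬_)

open import Level using (lift)
open import Data.Nat using (zero; suc; _+_; _∸_; _≟_; s≤s)
open import Data.Nat.Properties
open import Data.Product using (_,_; proj₁; proj₂)
open import Data.Sum using (_⊎_; inj₁; inj₂; [_,_])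
open import Data.List using ([])
open import Data.List.Extrema.Nat using (max; xs≤max)
import Data.List.Relation.Unary.All as All
open import Data.Empty using (⊥-elim)
open import Function using (_∘_)
open import Relation.Nullary using (Dec; yes; no)
open import Relation.Nullary.Decidable using (¬¬-excluded-middle)
open import Relation.Binary.PropositionalEquality using (_≡_; _≢_; refl; sym; trans; subst)

_∪_ : Subset → Subset → Subset
(S ∪ A) x = S x ⊎ A x

¬¬-∀< : {P : ℕ → Set} → (∀ k → ¬ ¬ P k) → ∀ N → ¬ ¬ (∀ k → k < N → P k)
¬¬-∀< ¬¬P zero ¬all = ¬all (λ _ ())
¬¬-∀< ¬¬P (suc N) ¬all = ¬¬-∀< ¬¬P N λ all<N → ¬¬P N λ pN →
  ¬all (λ k k<1+N → [ all<N k , (λ { refl → pN }) ] (m<1+n⇒m<n∨m≡n k<1+N))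

IsN⇒IsNumSG : ∀ {T} → IsN T → IsNumSG T
IsN⇒IsNumSG full = record
  { has-zero  = full 0
  ; closed    = λ a b _ _ → full (a + b)
  ; finite-co = [] , λ x ¬Tx → ⊥-elim (¬Tx (full x))
  }

module _ {T : Subset} (T-nsg : IsNumSG T) where
  open IsNumSG T-nsg

  gapBound : ℕ
  gapBound = suc (max 0 (proj₁ finite-co))

  gap<gapBound : ∀ {x} → ¬ T x → x < gapBound
  gap<gapBound {x} ¬Tx = s≤s (All.lookup (xs≤max 0 _) (proj₂ finite-co x ¬Tx))

  nonzero-element : (∀ x → Dec (T x)) → ∃ λ x → T x × x ≢ 0
  nonzero-element T? with T? gapBound
  ... | yes T-bound = gapBound , T-bound , λ ()
  ... | no ¬T-bound = ⊥-elim (<-irrefl refl (gap<gapBound ¬T-bound))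

  PF-+ : ∀ {a b} → PF T a → PF T b → ¬ T (a + b) → PF T (a + b)
  PF-+ {a} {b} (_ , a+) (_ , b+) ¬Ta+b = ¬Ta+b , λ s Ts s≢0 →
    subst T (sym (+-assoc a b s)) (a+ (b + s) (b+ s Ts s≢0) (s≢0 ∘ m+n≡0⇒n≡0 b))

  module _ {A : Subset} (A-pert : IPertinentSet T A) where
    private
      A⊆PF = proj₁ A-pert

    ∪-closed : (∀ a b → A a → A b → Dec (T (a + b))) →
               ∀ a b → (T ∪ A) a → (T ∪ A) b → (T ∪ A) (a + b)
    ∪-closed _ a b (inj₁ Ta) (inj₁ Tb) = inj₁ (closed a b Ta Tb)
    ∪-closed _ a b (inj₁ Ta) (inj₂ Ab) with a ≟ 0
    ... | yes refl = inj₂ Ab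
    ... | no a≢0   = inj₁ (subst T (+-comm b a) (proj₂ (A⊆PF b Ab) a Ta a≢0))
    ∪-closed _ a b (inj₂ Aa) (inj₁ Tb) with b ≟ 0
    ... | yes refl = inj₂ (subst A (sym (+-identityʳ a)) Aa)
    ... | no b≢0   = inj₁ (proj₂ (A⊆PF a Aa) b Tb b≢0)
    ∪-closed T? a b (inj₂ Aa) (inj₂ Ab) with T? a b Aa Ab
    ... | yes Ta+b = inj₁ Ta+b
    ... | no ¬Ta+b =
      inj₂ (proj₂ A-pert a b Aa Ab (PF-+ (A⊆PF a Aa) (A⊆PF b Ab) ¬Ta+b))

    ∪-isNumSG : (∀ a b → A a → A b → Dec (T (a + b))) → IsNumSG (T ∪ A)
    ∪-isNumSG T? = record
      { has-zero  = inj₁ has-zero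
      ; closed    = ∪-closed T?
      ; finite-co = proj₁ finite-co , λ x ¬Ux → proj₂ finite-co x (λ Tx → ¬Ux (inj₁ Tx))
      }

  ∪PF-InJ : ∀ {A} → (∀ x → A x → PF T x) → (∃ λ x → T x × x ≢ 0) → InJ (T ∪ A) T
  ∪PF-InJ {A} A⊆PF nz = T-nsg , nz , (λ x Tx → inj₁ (proj₁ Tx)) , absorb
    where
    sum≢0 : ∀ {i} d → i ≢ 0 → i + d ≢ 0
    sum≢0 {i} d i≢0 i+d≡0 = i≢0 (m+n≡0⇒m≡0 i i+d≡0)

    absorb : ∀ i d → T i × i ≢ 0 → (T ∪ A) d → T (i + d) × i + d ≢ 0
    absorb i d (Ti , i≢0) (inj₁ Td) = closed i d Ti Td , sum≢0 d i≢0
    absorb i d (Ti , i≢0) (inj₂ Ad) =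
      subst T (+-comm d i) (proj₂ (A⊆PF d Ad) i Ti i≢0) , sum≢0 d i≢0

chain-mono : ∀ θ S d m {x} → chain θ S m x → chain θ S (d + m) x
chain-mono θ S zero    m Sₘx = Sₘx
chain-mono θ S (suc d) m Sₘx = inj₁ (chain-mono θ S d m Sₘx)

module Chain (θ : Subset → Subset) (θ-pert : IPertinentMap θ)
  {S : Subset} (S-nsg : IsNumSG S) {n : ℕ} (Sₙ-full : IsN (chain θ S n))
  (Sₘ-proper : ∀ m → m < n → ¬ IsN (chain θ S m)) where

  private
    S_ = chain θ S
    c = gapBound S-nsg

  layer-gap<c : ∀ j {x} → ¬ S_ j x → x < c
  layer-gap<c j {x} ¬Sⱼx = gap<gapBound S-nsg λ Sx →
    ¬Sⱼx (subst (λ k → S_ k x) (+-identityʳ j) (chain-mono θ S j 0 Sx))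

  LayersDecidable : Set
  LayersDecidable = ∀ j → j < n → ∀ x → x < c + c → Dec (S_ j x)

  decidable⇒layer-isNumSG : LayersDecidable → ∀ j → j ≤ n → IsNumSG (S_ j)
  decidable⇒layer-isNumSG dec zero    _   = S-nsg
  decidable⇒layer-isNumSG dec (suc j) j<n = ∪-isNumSG Sⱼ-nsg θSⱼ-pert Sⱼ?
    where
    Sⱼ-nsg = decidable⇒layer-isNumSG dec j (<⇒≤ j<n)
    θSⱼ-pert = proj₂ (θ-pert (S_ j) Sⱼ-nsg (Sₘ-proper j j<n))

    θSⱼ<c : ∀ {a} → θ (S_ j) a → a < c
    θSⱼ<c {a} θa = layer-gap<c j (proj₁ (proj₁ θSⱼ-pert a θa))

    Sⱼ? : ∀ a b → θ (S_ j) a → θ (S_ j) b → Dec (S_ j (a + b))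
    Sⱼ? a b θa θb = dec j j<n (a + b) (+-mono-< (θSⱼ<c θa) (θSⱼ<c θb))

  θ-disjoint : ∀ j → j < n → ∀ x → θ (S_ j) x → ¬ S_ j x
  θ-disjoint j j<n x θx Sⱼx = ¬¬-dec λ dec →
    proj₁ (proj₁ (θSⱼ-pert dec) x θx) Sⱼx
    where
    θSⱼ-pert : LayersDecidable → IPertinentSet (S_ j) (θ (S_ j))
    θSⱼ-pert dec = proj₂ (θ-pert (S_ j) (decidable⇒layer-isNumSG dec j (<⇒≤ j<n)) (Sₘ-proper j j<n))

    ¬¬-dec : ¬ ¬ LayersDecidable
    ¬¬-dec = ¬¬-∀< (λ k → ¬¬-∀< (λ x → ¬¬-excluded-middle) (c + c)) n

  layer-dec : ∀ m → m ≤ n → ∀ x → Dec (S_ m x)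
  layer-dec m m≤n x =
    descend (n ∸ m) (≤-reflexive n∸m+m≡n) (subst (λ k → S_ k x) (sym n∸m+m≡n) (Sₙ-full x))
    where
    n∸m+m≡n = m∸n+n≡m m≤n
    descend : ∀ d → d + m ≤ n → S_ (d + m) x → Dec (S_ m x)
    descend zero    _   Sₘx = yes Sₘx
    descend (suc d) d+m<n (inj₁ Sx) = descend d (<⇒≤ d+m<n) Sx
    descend (suc d) d+m<n (inj₂ θx) =
      no λ Sₘx → θ-disjoint (d + m) d+m<n x θx (chain-mono θ S d m Sₘx)

  layer-isNumSG : ∀ j → j ≤ n → IsNumSG (S_ j)
  layer-isNumSG = decidable⇒layer-isNumSG λ j j<n x _ → layer-dec j (<⇒≤ j<n) x

  layer-InJ : ∀ j → j < n → InJ (S_ (suc j)) (S_ j)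
  layer-InJ j j<n = ∪PF-InJ Sⱼ-nsg θSⱼ⊆PF (nonzero-element Sⱼ-nsg (layer-dec j (<⇒≤ j<n)))
    where
    Sⱼ-nsg = layer-isNumSG j (<⇒≤ j<n)
    θSⱼ⊆PF = proj₁ (proj₂ (θ-pert (S_ j) Sⱼ-nsg (Sₘ-proper j j<n)))

  layer-InJk : ∀ d j → d + j ≡ n → InJk d (S_ j)
  layer-InJk zero    j refl = lift (IsN⇒IsNumSG Sₙ-full , Sₙ-full)
  layer-InJk (suc d) j d+1+j≡n =
    S_ (suc j) , layer-InJk d (suc j) (trans (+-suc d j) d+1+j≡n) , layer-InJ j j<n
    where
    j<n : j < n
    j<n = subst (suc j ≤_) d+1+j≡n (s≤s (m≤n+m j d))

  S∈Jⁿ : InJk n S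
  S∈Jⁿ = layer-InJk n 0 (+-identityʳ n)

corollary17 : (S : Subset) → IsNumSG S →
    (θ : Subset → Subset) → Extensional θ → IPertinentMap θ →
    (n : ℕ) → IsN (chain θ S n) → (∀ m → m < n → ¬ IsN (chain θ S m)) →
    ∃ λ k → k ≤ n × InJk k S
corollary17 S S-nsg θ _ θ-pert n Sₙ-full Sₘ-proper =
  n , ≤-refl , Chain.S∈Jⁿ θ θ-pert S-nsg Sₙ-full Sₘ-proper
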